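{- Let $k,l$ be positive integers, and for $n\ge 0$ let $c^{k,l}(n)$ denote the number of compositions of $n$ that fit inside a $k\times l$ rectangle, i.e. the number of sequences $(\kappa_1,\ldots,\kappa_r)$ of positive integers with $r\le k$, each $\kappa_i\le l$, and $\sum_i\kappa_i=n$ (the empty composition, with $r=0$, is counted for $n=0$). Let $f^{k,l}(q)=\sum_{n\ge 0}c^{k,l}(n)q^n$ and $[l]=1+q+\cdots+q^{l-1}$. (a) If $k\ge 2$ then $f^{k,l}=1+q\,[l]\,f^{k-1,l}$. (b) The polynomial $f^{k,l}$ is unimodal; that is, the sequence $c^{k,l}(0),c^{k,l}(1),\ldots,c^{k,l}(kl)$ is unimodal.
   Context: A sequence $a_0,a_1,\ldots,a_r$ of nonnegative numbers is unimodal if there is an index $m$ with $a_0\le a_1\le\cdots\le a_m\ge a_{m+1}\ge\cdots\ge a_r$. A polynomial is called unimodal if its sequence of coefficients is. -}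

module Defs where

open import Data.Nat using (ℕ; zero; suc; _+_; _*_; _∸_; _≤_; _<_; _≟_)
open import Data.Nat.Properties using ()
open import Data.List using (List; []; _∷_; map; concatMap; filter; length; upTo)
open import Data.Nat.ListAction using (sum)
open import Data.Product using (Σ; _×_; ∃-syntax)
open import Relation.Nullary.Decidable using (Dec; does)
open import Data.Bool using (if_then_else_)

-- All compositions fitting inside a k × l rectangle: lists (κ₁,…,κᵣ) of
-- integers with r ≤ k and 1 ≤ κᵢ ≤ l. Each is listed exactly once.
parts : ℕ → List ℕ
parts l = map suc (upTo l)

rectComps : ℕ → ℕ → List (List ℕ)
rectComps zero    l = [] ∷ []
rectComps (suc k) l = [] ∷ concatMap (λ a → map (a ∷_) (rectComps k l)) (parts l)

c : ℕ → ℕ → ℕ → ℕ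
c k l n = length (filter (λ κ → sum κ ≟ n) (rectComps k l))

-- Power series / polynomials with ℕ coefficients, as coefficient sequences.
Series : Set
Series = ℕ → ℕ

f : ℕ → ℕ → Series
f k l = c k l

one : Series
one zero    = 1
one (suc _) = 0

q : Series
q 1 = 1
q _ = 0

-- [l] = 1 + q + … + q^{l-1}
qint : ℕ → Series
qint l i = if does (suc i Data.Nat.≤? l) then 1 else 0

_⊕_ : Series → Series → Series
(a ⊕ b) n = a n + b n

_⊛_ : Series → Series → Series
(a ⊛ b) n = sum (map (λ i → a i * b (n ∸ i)) (upTo (suc n)))

infixl 6 _⊕_
infixl 7 _⊛_

Unimodal : (ℕ → ℕ) → ℕ → Set
Unimodal a r = ∃[ m ] (m ≤ r
  × (∀ i → suc i ≤ m → a i ≤ a (suc i))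
  × (∀ i → m ≤ i → suc i ≤ r → a (suc i) ≤ a i))

module Submission where

-- The compositions fitting in a k × l rectangle are the empty one together
-- with d ∷ κ for a first part d ∈ {1,…,l} and κ fitting in a (k-1) × l
-- rectangle.  Counting those of total n gives the recurrence
--   c^{k,l}(n) = [n = 0] + W(n),   W(n) = c^{k-1,l}(n-1) + … + c^{k-1,l}(n-l)
-- (terms with negative argument omitted), a sliding-window sum over the
-- last l values of c^{k-1,l}.  Part (a) is this recurrence read as the
-- product q·[l]·f^{k-1,l}.
-- For (b), a window sum W of a unimodal sequence a is unimodal:
--   W(n+1) - W(n) = a(n) - a(n-l)
-- changes sign only once, from non-negative to non-positive, because past
-- the mode of a the condition a(n) ≤ a(n-l) is preserved as n grows.
-- Adding [n = 0] keeps unimodality as W(0) = 0 < 1 ≤ a(0) = W(1), so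
-- induction on k shows every c^{k,l} is unimodal on all of ℕ, in
-- particular on 0, …, kl.

open import Defs
open import Data.Nat using (ℕ; zero; suc; _+_; _*_; _≤_; _<_; _∸_; z≤n; s≤s; _≟_; _≤?_; _≤′_; ≤′-refl; ≤′-step)
open import Data.Nat.Properties
open import Data.Nat.ListAction using (sum)
open import Data.List using (List; []; _∷_; map; concatMap; filter; length; upTo; applyUpTo; _++_)
open import Data.List.Properties using (length-++; length-map; map-∘; filter-++; filter-≐; filter-none)
open import Data.List.Relation.Unary.All using (universal)
open import Data.Product using (_×_; _,_; ∃-syntax)
open import Data.Bool using (true; false)
open import Data.Empty using (⊥-elim)
open import Data.Sum using (inj₁; inj₂)
open import Function using (_∘_; id)
open import Relation.Nullary using (¬_; yes; no; does)
open import Relation.Nullary.Decidable using (dec-true; dec-false; _×-dec_)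
open import Relation.Unary using (Decidable)
open import Relation.Binary.PropositionalEquality

∑< : ℕ → (ℕ → ℕ) → ℕ
∑< zero    g = 0
∑< (suc n) g = ∑< n g + g n

syntax ∑< n (λ i → e) = ∑[ i < n ] e
-- The summand extends over products but not over sums.
infix 6.5 ∑<

∑-front : ∀ g n → ∑[ i < suc n ] g i ≡ g 0 + ∑[ i < n ] g (suc i)
∑-front g zero    = +-comm 0 (g 0)
∑-front g (suc n) = begin
  ∑< (suc n) g + g (suc n)                   ≡⟨ cong (_+ g (suc n)) (∑-front g n) ⟩
  g 0 + ∑< n (g ∘ suc) + g (suc n)           ≡⟨ +-assoc (g 0) _ _ ⟩
  g 0 + (∑< n (g ∘ suc) + g (suc n))         ∎
  where open ≡-Reasoning

∑-cong : ∀ {g h : ℕ → ℕ} → (∀ i → g i ≡ h i) → ∀ n → ∑[ i < n ] g i ≡ ∑[ i < n ] h i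
∑-cong g≡h zero    = refl
∑-cong g≡h (suc n) = cong₂ _+_ (∑-cong g≡h n) (g≡h n)

∑-zero : ∀ n → ∑[ i < n ] 0 ≡ 0
∑-zero zero    = refl
∑-zero (suc n) = cong (_+ 0) (∑-zero n)

sum-applyUpTo : ∀ (h g : ℕ → ℕ) n → sum (map h (applyUpTo g n)) ≡ ∑[ i < n ] h (g i)
sum-applyUpTo h g zero    = refl
sum-applyUpTo h g (suc n) =
  trans (cong (h (g 0) +_) (sum-applyUpTo h (g ∘ suc) n)) (sym (∑-front (h ∘ g) n))

qint-in : ∀ {l i} → i < l → qint l i ≡ 1
qint-in {l} {i} i<l rewrite dec-true (suc i ≤? l) i<l = refl

qint-out : ∀ {l i} → l ≤ i → qint l i ≡ 0
qint-out {l} {i} l≤i rewrite dec-false (suc i ≤? l) (λ i<l → <⇒≱ i<l l≤i) = refl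

∑-qint-below : ∀ l (g : ℕ → ℕ) {n} → n ≤ l → ∑[ i < n ] qint l i * g i ≡ ∑[ i < n ] g i
∑-qint-below l g {zero}  _     = refl
∑-qint-below l g {suc n} n<l   =
  cong₂ _+_ (∑-qint-below l g (<⇒≤ n<l)) (trans (cong (_* g n) (qint-in n<l)) (+-identityʳ (g n)))

∑-qint-above : ∀ l (g : ℕ → ℕ) {n} → l ≤′ n → ∑[ i < n ] qint l i * g i ≡ ∑[ i < l ] g i
∑-qint-above l g ≤′-refl          = ∑-qint-below l g ≤-refl
∑-qint-above l g (≤′-step {n} l≤n) =
  trans (cong₂ _+_ (∑-qint-above l g l≤n) (cong (_* g n) (qint-out (≤′⇒≤ l≤n)))) (+-identityʳ _)

∑-qint-swap : ∀ l (g : ℕ → ℕ) n → ∑[ i < n ] qint l i * g i ≡ ∑[ i < l ] qint n i * g i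
∑-qint-swap l g n with ≤-total n l
... | inj₁ n≤l = trans (∑-qint-below l g n≤l) (sym (∑-qint-above n g (≤⇒≤′ n≤l)))
... | inj₂ l≤n = trans (∑-qint-above l g (≤⇒≤′ l≤n)) (sym (∑-qint-below n g l≤n))

q⊛-shift : ∀ (g : Series) i → (q ⊛ g) (suc i) ≡ g i
q⊛-shift g i = begin
  g i + 0 + sum (map (λ j → q j * g (suc i ∸ j)) (applyUpTo (suc ∘ suc) i))
    ≡⟨ cong (g i + 0 +_) (trans (sum-applyUpTo _ (suc ∘ suc) i) (∑-zero i)) ⟩
  g i + 0 + 0
    ≡⟨ trans (+-identityʳ _) (+-identityʳ _) ⟩
  g i ∎
  where open ≡-Reasoning

q⊛-conv : ∀ (g F : Series) n → (q ⊛ g ⊛ F) n ≡ ∑[ i < n ] g i * F (n ∸ suc i)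
q⊛-conv g F n = begin
  (q ⊛ g ⊛ F) n                              ≡⟨ sum-applyUpTo _ id (suc n) ⟩
  ∑[ i < suc n ] (q ⊛ g) i * F (n ∸ i)       ≡⟨ ∑-front _ n ⟩
  ∑[ i < n ] (q ⊛ g) (suc i) * F (n ∸ suc i) ≡⟨ ∑-cong (λ i → cong (_* F (n ∸ suc i)) (q⊛-shift g i)) n ⟩
  ∑[ i < n ] g i * F (n ∸ suc i)             ∎
  where open ≡-Reasoning

module _ {A B : Set} {P : A → Set} (P? : Decidable P) where

  filter-map : ∀ (g : B → A) xs → filter P? (map g xs) ≡ map g (filter (P? ∘ g) xs)
  filter-map g []       = refl
  filter-map g (x ∷ xs) with does (P? (g x))
  ... | true  = cong (g x ∷_) (filter-map g xs)
  ... | false = filter-map g xs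

  count-concatMap : ∀ (G : B → List A) xs →
    length (filter P? (concatMap G xs)) ≡ sum (map (λ x → length (filter P? (G x))) xs)
  count-concatMap G []       = refl
  count-concatMap G (x ∷ xs) = begin
    length (filter P? (G x ++ concatMap G xs))
      ≡⟨ cong length (filter-++ P? (G x) (concatMap G xs)) ⟩
    length (filter P? (G x) ++ filter P? (concatMap G xs))
      ≡⟨ length-++ (filter P? (G x)) ⟩
    length (filter P? (G x)) + length (filter P? (concatMap G xs))
      ≡⟨ cong (length (filter P? (G x)) +_) (count-concatMap G xs) ⟩
    length (filter P? (G x)) + sum (map (λ y → length (filter P? (G y))) xs) ∎
    where open ≡-Reasoning

countSum : ℕ → List (List ℕ) → ℕ
countSum n xs = length (filter (λ κ → sum κ ≟ n) xs)

countSum-nil : ∀ n xs → countSum n ([] ∷ xs) ≡ one n + countSum n xs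
countSum-nil zero    xs = refl
countSum-nil (suc n) xs = refl

countSum-cons-≤ : ∀ {d n} xs → d ≤ n → countSum n (map (d ∷_) xs) ≡ countSum (n ∸ d) xs
countSum-cons-≤ {d} {n} xs d≤n = begin
  length (filter (λ κ → sum κ ≟ n) (map (d ∷_) xs))
    ≡⟨ cong length (filter-map (λ κ → sum κ ≟ n) (d ∷_) xs) ⟩
  length (map (d ∷_) (filter (λ κ → d + sum κ ≟ n) xs))
    ≡⟨ length-map (d ∷_) (filter (λ κ → d + sum κ ≟ n) xs) ⟩
  length (filter (λ κ → d + sum κ ≟ n) xs)
    ≡⟨ cong length (filter-≐ (λ κ → d + sum κ ≟ n) (λ κ → sum κ ≟ n ∸ d) ((λ {κ} → sum≡n∸d κ) , (λ {κ} → d+sum≡n κ)) xs) ⟩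
  countSum (n ∸ d) xs ∎
  where
  open ≡-Reasoning
  sum≡n∸d : ∀ κ → d + sum κ ≡ n → sum κ ≡ n ∸ d
  sum≡n∸d κ e = trans (sym (m+n∸m≡n d (sum κ))) (cong (_∸ d) e)
  d+sum≡n : ∀ κ → sum κ ≡ n ∸ d → d + sum κ ≡ n
  d+sum≡n κ e = trans (cong (d +_) e) (m+[n∸m]≡n d≤n)

countSum-cons-> : ∀ {d n} xs → n < d → countSum n (map (d ∷_) xs) ≡ 0
countSum-cons-> {d} {n} xs n<d = cong length (begin
  filter (λ κ → sum κ ≟ n) (map (d ∷_) xs)            ≡⟨ filter-map (λ κ → sum κ ≟ n) (d ∷_) xs ⟩
  map (d ∷_) (filter (λ κ → d + sum κ ≟ n) xs)        ≡⟨ cong (map (d ∷_)) (filter-none _ (universal too-big xs)) ⟩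
  [] ∎)
  where
  open ≡-Reasoning
  too-big : ∀ κ → d + sum κ ≢ n
  too-big κ e = <⇒≱ n<d (subst (d ≤_) e (m≤m+n d (sum κ)))

-- Both cases at once, with the indicator [i + 1 ≤ n] written as qint n i.
countSum-cons : ∀ i n xs → countSum n (map (suc i ∷_) xs) ≡ qint n i * countSum (n ∸ suc i) xs
countSum-cons i n xs with suc i ≤? n
... | yes i<n = trans (countSum-cons-≤ xs i<n)
                      (sym (trans (cong (_* rest) (qint-in i<n)) (+-identityʳ rest)))
  where rest = countSum (n ∸ suc i) xs
... | no  i≮n = trans (countSum-cons-> xs (≰⇒> i≮n))
                      (sym (cong (_* countSum (n ∸ suc i) xs) (qint-out (≤-pred (≰⇒> i≮n)))))

-- The sliding window of width l: window l a n = a(n-1) + … + a(n-l),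
-- where the terms with n - 1 - i negative are omitted.
window : ℕ → Series → Series
window l a n = ∑[ i < l ] qint n i * a (n ∸ suc i)

-- Splitting a composition in a (k+1) × l box into its first part and the rest:
-- c^{k+1,l}(n) = [n = 0] + ∑_{d=1}^{l} c^{k,l}(n-d).
c-recurrence : ∀ k l n → c (suc k) l n ≡ one n + window l (c k l) n
c-recurrence k l n = begin
  countSum n ([] ∷ concatMap prepend (parts l))
    ≡⟨ countSum-nil n _ ⟩
  one n + countSum n (concatMap prepend (parts l))
    ≡⟨ cong (one n +_) (count-concatMap (λ κ → sum κ ≟ n) prepend (parts l)) ⟩
  one n + sum (map (λ d → countSum n (prepend d)) (map suc (upTo l)))
    ≡⟨ cong (λ xs → one n + sum xs) (sym (map-∘ (upTo l))) ⟩
  one n + sum (map (λ i → countSum n (prepend (suc i))) (upTo l))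
    ≡⟨ cong (one n +_) (sum-applyUpTo _ id l) ⟩
  one n + ∑[ i < l ] countSum n (prepend (suc i))
    ≡⟨ cong (one n +_) (∑-cong (λ i → countSum-cons i n (rectComps k l)) l) ⟩
  one n + window l (c k l) n ∎
  where
  open ≡-Reasoning
  prepend : ℕ → List (List ℕ)
  prepend d = map (d ∷_) (rectComps k l)

q⊛qint-window : ∀ l (a : Series) n → (q ⊛ qint l ⊛ a) n ≡ window l a n
q⊛qint-window l a n =
  trans (q⊛-conv (qint l) a n) (∑-qint-swap l (λ i → a (n ∸ suc i)) n)

-- Part (a), valid already for k ≥ 1: f^{k+1,l} = 1 + q[l] f^{k,l}.
f-recurrence : ∀ k l n → f (suc k) l n ≡ (one ⊕ q ⊛ qint l ⊛ f k l) n
f-recurrence k l n =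
  trans (c-recurrence k l n) (cong (one n +_) (sym (q⊛qint-window l (c k l) n)))

RisesTo : Series → ℕ → Set
RisesTo a m = ∀ i → suc i ≤ m → a i ≤ a (suc i)

FallsFrom : Series → ℕ → Set
FallsFrom a m = ∀ i → m ≤ i → a (suc i) ≤ a i

UnimodalSeq : Series → Set
UnimodalSeq a = ∃[ m ] (RisesTo a m × FallsFrom a m)

rise-range : ∀ {a m i j} → RisesTo a m → i ≤ j → j ≤ m → a i ≤ a j
rise-range {a} {m} {i} rises i≤j = go (≤⇒≤′ i≤j)
  where
  go : ∀ {j} → i ≤′ j → j ≤ m → a i ≤ a j
  go ≤′-refl                 _    = ≤-refl
  go (≤′-step {j} i≤′j) j<m = ≤-trans (go i≤′j (<⇒≤ j<m)) (rises j j<m)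

fall-range : ∀ {a m i j} → FallsFrom a m → m ≤ i → i ≤ j → a j ≤ a i
fall-range {a} {m} {i} falls m≤i i≤j = go (≤⇒≤′ i≤j)
  where
  go : ∀ {j} → i ≤′ j → a j ≤ a i
  go ≤′-refl              = ≤-refl
  go (≤′-step {j} i≤′j) = ≤-trans (falls j (≤-trans m≤i (≤′⇒≤ i≤′j))) (go i≤′j)

shift-domination : ∀ {a m i j} → RisesTo a m → FallsFrom a m →
  m ≤ i → j ≤ i → a i ≤ a j → a (suc i) ≤ a (suc j)
shift-domination {m = m} {j = j} rises falls m≤i j≤i ai≤aj with suc j ≤? m
... | yes j<m = ≤-trans (falls _ m≤i) (≤-trans ai≤aj (rises j j<m))
... | no  j≮m = fall-range falls (m≤n⇒m≤1+n (≤-pred (≰⇒> j≮m))) (s≤s j≤i)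

finite-unimodal : ∀ {a} → UnimodalSeq a → ∀ r → Unimodal a r
finite-unimodal (m , rises , falls) r with m ≤? r
... | yes m≤r = m , m≤r , rises , (λ i m≤i _ → falls i m≤i)
... | no  m≰r = r , ≤-refl , (λ i i<r → rises i (≤-trans i<r (<⇒≤ (≰⇒> m≰r)))) ,
                (λ i r≤i i<r → ⊥-elim (<⇒≱ i<r r≤i))

unimodal-cong : ∀ {a b} → (∀ n → a n ≡ b n) → UnimodalSeq a → UnimodalSeq b
unimodal-cong a≡b (m , rises , falls) =
  m , (λ i i<m → subst₂ _≤_ (a≡b i) (a≡b (suc i)) (rises i i<m))
    , (λ i m≤i → subst₂ _≤_ (a≡b (suc i)) (a≡b i) (falls i m≤i))

unimodal-bump : ∀ {b} → UnimodalSeq b → b 0 < b 1 → UnimodalSeq (one ⊕ b)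
unimodal-bump (zero  , _     , falls) b₀<b₁ = ⊥-elim (<⇒≱ b₀<b₁ (falls 0 z≤n))
unimodal-bump (suc m , rises , falls) b₀<b₁ = suc m , rises′ , falls′
  where
  rises′ : RisesTo (one ⊕ _) (suc m)
  rises′ zero    _   = b₀<b₁
  rises′ (suc i) i<m = rises (suc i) i<m
  falls′ : FallsFrom (one ⊕ _) (suc m)
  falls′ (suc i) m≤i = falls (suc i) m≤i

threshold : ∀ {D : ℕ → Set} → Decidable D → (∀ n → D n → D (suc n)) → ∀ {N} → D N →
  ∃[ M ] ((∀ n → n < M → ¬ D n) × (∀ n → M ≤ n → D n))
threshold {D} D? D-up = search
  where
  upward : ∀ {i j} → D i → i ≤′ j → D j
  upward Di ≤′-refl        = Di
  upward Di (≤′-step i≤′j) = D-up _ (upward Di i≤′j)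
  from : ∀ {i} → D i → ∀ n → i ≤ n → D n
  from Di n i≤n = upward Di (≤⇒≤′ i≤n)
  search : ∀ {N} → D N → ∃[ M ] ((∀ n → n < M → ¬ D n) × (∀ n → M ≤ n → D n))
  search {zero}  D₀ = zero , (λ n ()) , from D₀
  search {suc N} DN with D? N
  ... | yes DN′ = search DN′
  ... | no ¬DN′ = suc N , (λ n n<N Dn → ¬DN′ (from Dn N (≤-pred n<N))) , from DN

unimodal-by-sign-change : ∀ {D : ℕ → Set} (b : Series) → Decidable D →
  (∀ n → D n → D (suc n)) → ∃[ N ] D N →
  (∀ n → ¬ D n → b n ≤ b (suc n)) → (∀ n → D n → b (suc n) ≤ b n) → UnimodalSeq b
unimodal-by-sign-change b D? D-up (N , DN) rising falling
  with threshold D? D-up DN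
... | M , below , above =
  M , (λ i i<M → rising i (below i i<M)) , (λ i M≤i → falling i (above i M≤i))

-- Sliding the window by one: a(n) enters and a(n-l) leaves (if n ≥ l),
-- W(n+1) + qint n (l-1)·a(n-l) = W(n) + a(n).
window-step : ∀ l′ (a : Series) n →
  window (suc l′) a (suc n) + qint n l′ * a (n ∸ suc l′) ≡ window (suc l′) a n + a n
window-step l′ a n = begin
  window (suc l′) a (suc n) + leaving  ≡⟨ cong (_+ leaving) (∑-front _ l′) ⟩
  a n + 0 + kept + leaving             ≡⟨ cong (λ x → x + kept + leaving) (+-identityʳ (a n)) ⟩
  a n + kept + leaving                 ≡⟨ +-assoc (a n) kept leaving ⟩
  a n + (kept + leaving)               ≡⟨ +-comm (a n) (kept + leaving) ⟩
  kept + leaving + a n                 ∎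
  where
  open ≡-Reasoning
  leaving = qint n l′ * a (n ∸ suc l′)
  kept    = ∑[ i < l′ ] qint n i * a (n ∸ suc i)

window-zero : ∀ l (a : Series) → window l a 0 ≡ 0
window-zero l a = ∑-zero l

window-one : ∀ l′ (a : Series) → window (suc l′) a 1 ≡ a 0
window-one l′ a = trans (sym (+-identityʳ _)) (trans (window-step l′ a 0) (cong (_+ a 0) (window-zero (suc l′) a)))

-- A window sum of a unimodal sequence is unimodal: with m the mode of a,
-- the property D(n) = (m ≤ n and a(n) ≤ a(n-l)) is upward closed, holds at
-- n = m + l, and by window-step W falls where D holds and rises elsewhere.
window-unimodal : ∀ l′ (a : Series) → UnimodalSeq a → UnimodalSeq (window (suc l′) a)
window-unimodal l′ a (m , rises , falls) =
  unimodal-by-sign-change W D? D-up (m + l , D-at-m+l) rising-off-D (λ n (_ , an≤e) → falling n an≤e)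
  where
  l = suc l′
  W = window l a
  leaving : ℕ → ℕ
  leaving n = qint n l′ * a (n ∸ l)
  leaving-old : ∀ {n} → l ≤ n → leaving n ≡ a (n ∸ l)
  leaving-old {n} l≤n = trans (cong (_* a (n ∸ l)) (qint-in l≤n)) (+-identityʳ _)
  leaving-none : ∀ {n} → n < l → leaving n ≡ 0
  leaving-none {n} n<l = cong (_* a (n ∸ l)) (qint-out (≤-pred n<l))
  rising : ∀ n → leaving n ≤ a n → W n ≤ W (suc n)
  rising n e≤an = +-cancelʳ-≤ (leaving n) _ _
    (subst (W n + leaving n ≤_) (sym (window-step l′ a n)) (+-monoʳ-≤ (W n) e≤an))
  falling : ∀ n → a n ≤ leaving n → W (suc n) ≤ W n
  falling n an≤e = +-cancelʳ-≤ (a n) _ _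
    (subst (W (suc n) + a n ≤_) (window-step l′ a n) (+-monoʳ-≤ (W (suc n)) an≤e))
  leaving-before-mode : ∀ {n} → n ≤ m → leaving n ≤ a n
  leaving-before-mode {n} n≤m with l ≤? n
  ... | yes l≤n = subst (_≤ a n) (sym (leaving-old l≤n)) (rise-range rises (m∸n≤m n l) n≤m)
  ... | no  l≰n = subst (_≤ a n) (sym (leaving-none (≰⇒> l≰n))) z≤n
  D : ℕ → Set
  D n = m ≤ n × a n ≤ leaving n
  D? : Decidable D
  D? n = (m ≤? n) ×-dec (a n ≤? leaving n)
  D-up : ∀ n → D n → D (suc n)
  D-up n (m≤n , an≤e) with l ≤? n
  ... | yes l≤n = m≤n⇒m≤1+n m≤n , subst (a (suc n) ≤_) (sym leaving-next)
        (shift-domination rises falls m≤n (m∸n≤m n l) (subst (a n ≤_) (leaving-old l≤n) an≤e))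
    where
    leaving-next : leaving (suc n) ≡ a (suc (n ∸ l))
    leaving-next = trans (leaving-old (m≤n⇒m≤1+n l≤n)) (cong a (+-∸-assoc 1 l≤n))
  ... | no  l≰n = m≤n⇒m≤1+n m≤n ,
        ≤-trans (≤-trans (falls n m≤n) (subst (a n ≤_) (leaving-none (≰⇒> l≰n)) an≤e)) z≤n
  D-at-m+l : D (m + l)
  D-at-m+l = m≤m+n m l , subst (a (m + l) ≤_)
    (sym (trans (leaving-old (m≤n+m l m)) (cong a (m+n∸n≡m m l))))
    (fall-range falls ≤-refl (m≤m+n m l))
  rising-off-D : ∀ n → ¬ D n → W n ≤ W (suc n)
  rising-off-D n ¬Dn with m ≤? n
  ... | yes m≤n = rising n (<⇒≤ (≰⇒> (λ an≤e → ¬Dn (m≤n , an≤e))))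
  ... | no  m≰n = rising n (leaving-before-mode (<⇒≤ (≰⇒> m≰n)))

c-empty : ∀ k l → 0 < c k l 0
c-empty zero    l = s≤s z≤n
c-empty (suc k) l = s≤s z≤n

c-unimodal : ∀ k l′ → UnimodalSeq (c k (suc l′))
c-unimodal zero    l′ = 0 , (λ _ ()) , (λ _ _ → z≤n)
c-unimodal (suc k) l′ =
  unimodal-cong (λ n → sym (c-recurrence k (suc l′) n))
    (unimodal-bump (window-unimodal l′ (c k (suc l′)) (c-unimodal k l′))
      (subst₂ _<_ (sym (window-zero (suc l′) (c k (suc l′)))) (sym (window-one l′ (c k (suc l′))))
        (c-empty k (suc l′))))

theorem2p2 : (k l : ℕ) → 1 ≤ k → 1 ≤ l →
    (2 ≤ k → ∀ n → f k l n ≡ (one ⊕ q ⊛ qint l ⊛ f (k ∸ 1) l) n)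
    × Unimodal (c k l) (k * l)
theorem2p2 (suc k) (suc l′) _ _ =
  (λ _ → f-recurrence k (suc l′)) , finite-unimodal (c-unimodal (suc k) l′) (suc k * suc l′)
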